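{- Let $A$ be a graph of order $n$ and $\hat A$ its stable graph. If all cells of the stable partition of $A$ (the partition of $[n]$ into classes of vertices with equal diagonal entries of $\hat A$) are singletons, then $\mathrm{Aut}(A)$ is the trivial group.
   Context: Labels are independent commuting indeterminates $x_0,x_1,\dots$; $\mathrm{Var}=\{x_1,x_2,\dots\}$. A graph of order $n$ is a symmetric $n\times n$ matrix over $\{x_0\}\cup\mathrm{Var}$; $\dim$ is its number of distinct entries; an automorphism of $G$ is a permutation $\sigma$ of $[n]$ with $g_{i^\sigma j^\sigma}=g_{ij}$ for all $i,j$. Powers are computed in the commutative polynomial ring over $\mathbb{R}$ in the indeterminates and an extra indeterminate $\lambda$ ($A^0=I$). An equivalent variable substitution replaces the entries of a matrix by variables of $\mathrm{Var}$, equal entries by equal variables and distinct by distinct. The description graph $\tilde G$ is obtained from $\sum_{k=0}^{n-1}\lambda^kG^k$ by an equivalent variable substitution; the stable graph $\hat A$ is $A_t$ where $A_0=A$, $A_{k+1}=\tilde{A_k}$, and $t$ is the first index with $\dim(A_t)=\dim(A_{t+1})$. -}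

module Defs where

open import Data.Nat using (ℕ; zero; suc; _≤_; _<_; _≟_)
open import Data.Fin using (Fin) renaming (_≟_ to _≟F_)
open import Data.List using (List; []; _∷_; _++_; map; concat; concatMap; allFin; replicate; length; deduplicate; upTo)
open import Data.Product using (_×_)
open import Function.Bundles using (_⇔_)
open import Relation.Binary.PropositionalEquality using (_≡_; setoid)
open import Data.Fin.Permutation using (Permutation′; _⟨$⟩ʳ_)
open import Relation.Nullary using (¬_; yes; no)
import Data.List.Relation.Binary.Permutation.Setoid as PermS

-- Graphs: a graph of order n is a symmetric n×n matrix of labels;
-- the label x_i is represented by its index i : ℕ (x_0 is index 0,
-- Var = {x_1, x_2, ...} are the indices ≥ 1).

Matrix : Set → ℕ → Set
Matrix X n = Fin n → Fin n → X

Graph : ℕ → Set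
Graph n = Matrix ℕ n

Symmetric : ∀ {n} → Graph n → Set
Symmetric {n} G = (i j : Fin n) → G i j ≡ G j i

entries : ∀ {n} → Graph n → List ℕ
entries {n} G = concatMap (λ i → map (G i) (allFin n)) (allFin n)

dim : ∀ {n} → Graph n → ℕ
dim G = length (deduplicate _≟_ (entries G))

-- Every polynomial occurring here (Σ λ^k G^k) has coefficients in ℕ,
-- and ℕ[X] embeds in ℝ[X], so we represent polynomials by their
-- ℕ-coefficient normal form: a polynomial is a finite multiset of
-- monomials (a monomial with coefficient c appears c times) and a
-- monomial is a finite multiset of indeterminates.

data Ind : Set where
  lam : Ind
  var : ℕ → Ind

Mono : Set
Mono = List Ind

Poly : Set
Poly = List Mono

-- equality of monomials: equality as multisets (commutativity)
module MonoEq = PermS (setoid Ind)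

module PolyEq = PermS MonoEq.↭-setoid

infix 4 _≈ₚ_
_≈ₚ_ : Poly → Poly → Set
_≈ₚ_ = PolyEq._↭_

0ₚ : Poly
0ₚ = []

1ₚ : Poly
1ₚ = [] ∷ []

_+ₚ_ : Poly → Poly → Poly
_+ₚ_ = _++_

_*ₚ_ : Poly → Poly → Poly
p *ₚ q = concatMap (λ m → map (m ++_) q) p

sumₚ : List Poly → Poly
sumₚ = concat

lamPow : ℕ → Poly
lamPow k = replicate k lam ∷ []

idM : ∀ {n} → Matrix Poly n
idM i j with i ≟F j
... | yes _ = 1ₚ
... | no _ = 0ₚ

_*M_ : ∀ {n} → Matrix Poly n → Matrix Poly n → Matrix Poly n
_*M_ {n} M N i j = sumₚ (map (λ l → M i l *ₚ N l j) (allFin n))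

powM : ∀ {n} → Matrix Poly n → ℕ → Matrix Poly n
powM M zero = idM
powM M (suc k) = M *M powM M k

toPolyM : ∀ {n} → Graph n → Matrix Poly n
toPolyM G i j = (var (G i j) ∷ []) ∷ []

descrPoly : ∀ {n} → Graph n → Matrix Poly n
descrPoly {n} G i j =
  sumₚ (map (λ k → lamPow k *ₚ powM (toPolyM G) k i j) (upTo n))

IsEquivVarSubst : ∀ {n} → Matrix Poly n → Graph n → Set
IsEquivVarSubst {n} M B =
  ((i j : Fin n) → 1 ≤ B i j) ×
  ((i j k l : Fin n) → (B i j ≡ B k l) ⇔ (M i j ≈ₚ M k l))

IsDescriptionGraph : ∀ {n} → Graph n → Graph n → Set
IsDescriptionGraph G B = IsEquivVarSubst (descrPoly G) B

-- (As, t) is a run of the stable-graph construction from A: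
-- A_0 = A, A_{k+1} = ~A_k (for k ≤ t), t is the first index with
-- dim A_t = dim A_{t+1}; then the stable graph is A_t.
IsStableRun : ∀ {n} → Graph n → (ℕ → Graph n) → ℕ → Set
IsStableRun A As t =
  (As 0 ≡ A) ×
  ((k : ℕ) → k ≤ t → IsDescriptionGraph (As k) (As (suc k))) ×
  ((k : ℕ) → k < t → ¬ (dim (As k) ≡ dim (As (suc k)))) ×
  (dim (As t) ≡ dim (As (suc t)))

IsAutomorphism : ∀ {n} → Graph n → Permutation′ n → Set
IsAutomorphism {n} G σ = (i j : Fin n) → G (σ ⟨$⟩ʳ i) (σ ⟨$⟩ʳ j) ≡ G i j

-- An automorphism σ of G permutes the rows and columns of every power of G,
-- so reindexing the matrix sums by σ shows that entry (σ i, σ j) of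
-- Σ λ^k G^k is the same polynomial as entry (i, j). An equivalent variable
-- substitution reflects equality of entries, so σ is again an automorphism
-- of the description graph, and by induction of the stable graph. Hence σ
-- maps each vertex to one with the same diagonal entry, i.e. into its own
-- cell of the stable partition; singleton cells force σ = id.

module Submission where

open import Defs
open import Data.Nat using (ℕ; zero; suc; _≤_)
open import Data.Nat.Properties using (≤-refl; ≤-trans; n≤1+n)
open import Data.Fin using (Fin) renaming (_≟_ to _≟F_)
open import Data.Fin.Permutation using (Permutation′; _⟨$⟩ʳ_; _⟨$⟩ˡ_; inverseʳ)
open import Data.List using (List; []; _∷_; map; concatMap; allFin; upTo)
open import Data.List.Properties using (concatMap-map)
open import Data.List.Membership.Propositional using (_∈_)
open import Data.List.Membership.Propositional.Properties using (∈-map⁺; ∈-allFin)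
open import Data.List.Membership.Propositional.Properties.WithK using (unique∧set⇒bag)
open import Data.List.Relation.Unary.Unique.Propositional.Properties using (map⁺; allFin⁺)
open import Data.List.Relation.Binary.BagAndSetEquality
  using (_∼[_]_; bag; [_]-Equality; >>=-cong; map-cong; ∼bag⇒↭)
open import Data.List.Relation.Binary.Permutation.Propositional using (↭⇒↭ₛ′)
open import Data.Product using (_,_)
open import Function using (_∘_)
open import Function.Bundles using (Injection; Equivalence; mk⇔)
open import Function.Properties.Inverse using (↔⇒↣)
open import Relation.Binary.Bundles using (Setoid)
open import Relation.Binary.PropositionalEquality using (_≡_; refl; cong; subst)
open import Relation.Nullary using (yes; no; contradiction)
import Relation.Binary.Reasoning.Setoid as SetoidReasoning

-- Polynomial identities are proved up to bag equality, for which the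
-- library's >>=-cong gives both reindexing and termwise congruence of sums.
module Bag {A : Set} = Setoid ([ bag ]-Equality A)

bag⇒≈ₚ : ∀ {p q} → p ∼[ bag ] q → p ≈ₚ q
bag⇒≈ₚ = ↭⇒↭ₛ′ (Setoid.isEquivalence MonoEq.↭-setoid) ∘ ∼bag⇒↭

*ₚ-cong : ∀ {p p′ q q′} → p ∼[ bag ] p′ → q ∼[ bag ] q′ → p *ₚ q ∼[ bag ] p′ *ₚ q′
*ₚ-cong p∼p′ q∼q′ = >>=-cong p∼p′ (λ m → map-cong (λ _ → refl) q∼q′)

module _ {n : ℕ} (σ : Permutation′ n) where

  private
    s : Fin n → Fin n
    s = σ ⟨$⟩ʳ_

    s-injective : ∀ {i j} → s i ≡ s j → i ≡ j
    s-injective = Injection.injective (↔⇒↣ σ)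

  allFin-permute : map s (allFin n) ∼[ bag ] allFin n
  allFin-permute = unique∧set⇒bag (map⁺ s-injective (allFin⁺ n)) (allFin⁺ n)
    (λ {z} → mk⇔ (λ _ → ∈-allFin z)
                  (λ _ → subst (_∈ map s (allFin n)) (inverseʳ σ) (∈-map⁺ s (∈-allFin (σ ⟨$⟩ˡ z)))))

  concatMap-permute : ∀ {A : Set} (f : Fin n → List A) →
                      concatMap (f ∘ s) (allFin n) ∼[ bag ] concatMap f (allFin n)
  concatMap-permute f = begin
    concatMap (f ∘ s) (allFin n)    ≡⟨ concatMap-map f s (allFin n) ⟨
    concatMap f (map s (allFin n))  ≈⟨ >>=-cong allFin-permute (λ _ → Bag.refl) ⟩
    concatMap f (allFin n)          ∎
    where open SetoidReasoning ([ bag ]-Equality _)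

  Invariant : Matrix Poly n → Set
  Invariant M = ∀ i j → M (s i) (s j) ∼[ bag ] M i j

  idM-invariant : Invariant idM
  idM-invariant i j = Bag.reflexive (idM-permute i j)
    where
    idM-permute : ∀ i j → idM (s i) (s j) ≡ idM i j
    idM-permute i j with i ≟F j | s i ≟F s j
    ... | yes _    | yes _ = refl
    ... | no _     | no _  = refl
    ... | yes refl | no si≢sj = contradiction refl si≢sj
    ... | no i≢j   | yes si≡sj = contradiction (s-injective si≡sj) i≢j

  *M-invariant : ∀ {M N} → Invariant M → Invariant N → Invariant (M *M N)
  *M-invariant {M} {N} M-inv N-inv i j = begin
    concatMap (λ l → M (s i) l *ₚ N l (s j)) (allFin n)
      ≈⟨ concatMap-permute _ ⟨
    concatMap (λ l → M (s i) (s l) *ₚ N (s l) (s j)) (allFin n)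
      ≈⟨ >>=-cong (Bag.refl {x = allFin n}) (λ l → *ₚ-cong (M-inv i l) (N-inv l j)) ⟩
    concatMap (λ l → M i l *ₚ N l j) (allFin n)
      ∎
    where open SetoidReasoning ([ bag ]-Equality _)

  powM-invariant : ∀ {M} → Invariant M → ∀ k → Invariant (powM M k)
  powM-invariant M-inv zero    = idM-invariant
  powM-invariant M-inv (suc k) = *M-invariant M-inv (powM-invariant M-inv k)

  toPolyM-invariant : ∀ {G} → IsAutomorphism G σ → Invariant (toPolyM G)
  toPolyM-invariant {G} aut i j = Bag.reflexive (cong (λ x → (var x ∷ []) ∷ []) (aut i j))

  descrPoly-invariant : ∀ {G} → IsAutomorphism G σ → Invariant (descrPoly G)
  descrPoly-invariant aut i j =
    >>=-cong (Bag.refl {x = upTo n})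
      (λ k → *ₚ-cong (Bag.refl {x = lamPow k}) (powM-invariant (toPolyM-invariant aut) k i j))

  equivVarSubst-automorphism : ∀ {M B} → IsEquivVarSubst M B → Invariant M → IsAutomorphism B σ
  equivVarSubst-automorphism (_ , B≡⇔M≈) M-inv i j =
    Equivalence.from (B≡⇔M≈ (s i) (s j) i j) (bag⇒≈ₚ (M-inv i j))

  descriptionGraph-automorphism : ∀ {G B} → IsDescriptionGraph G B →
                                  IsAutomorphism G σ → IsAutomorphism B σ
  descriptionGraph-automorphism desc aut =
    equivVarSubst-automorphism desc (descrPoly-invariant aut)

  stableRun-automorphism : ∀ {A As t} → IsStableRun A As t → IsAutomorphism A σ →
                           ∀ k → k ≤ t → IsAutomorphism (As k) σ
  stableRun-automorphism (refl , _) aut zero _ = aut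
  stableRun-automorphism {t = t} run@(_ , desc , _) aut (suc k) 1+k≤t =
    descriptionGraph-automorphism (desc k k≤t) (stableRun-automorphism run aut k k≤t)
    where
    k≤t : k ≤ t
    k≤t = ≤-trans (n≤1+n k) 1+k≤t

  diagonal-injective⇒automorphism-trivial : ∀ {G} → IsAutomorphism G σ →
    (∀ i j → G i i ≡ G j j → i ≡ j) → ∀ i → s i ≡ i
  diagonal-injective⇒automorphism-trivial aut diag-inj i = diag-inj (s i) i (aut i i)

corollary4 : (n : ℕ) (A : Graph n) → Symmetric A →
    (As : ℕ → Graph n) (t : ℕ) → IsStableRun A As t →
    ((i j : Fin n) → As t i i ≡ As t j j → i ≡ j) →
    (σ : Permutation′ n) → IsAutomorphism A σ → (i : Fin n) → σ ⟨$⟩ʳ i ≡ i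
corollary4 n A _ As t run singletonCells σ aut =
  diagonal-injective⇒automorphism-trivial σ
    (stableRun-automorphism σ run aut t ≤-refl) singletonCells
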